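{- Let $G$ be a connected graph and $V_{\rm NT}\subseteq V(G)$. Let $G'$ be the graph obtained from $G$ by deleting all vertices of $V(G)\setminus N[V_{\rm NT}]$, adding a new vertex $r$, and making $r$ adjacent to every vertex of $N(V_{\rm NT})$. Then $G$ has a spanning tree in which every vertex of $V_{\rm NT}$ has degree at least $2$ if and only if $G'$ has a spanning tree in which every vertex of $V_{\rm NT}$ has degree at least $2$.
   Context: For a vertex set $X$, $N[X]$ is the set of vertices in $X$ or adjacent to a vertex of $X$, and $N(X)=N[X]\setminus X$. -}

module Defs where

open import Data.Bool using (Bool; true; false; _∨_; _∧_; not)
open import Data.Nat using (ℕ; zero; suc; _≤_)
open import Data.Fin using (Fin)
open import Data.Fin.Subset using (Subset)
open import Data.Vec using (lookup)
open import Data.Maybe using (Maybe; just; nothing)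
open import Data.List using (List; []; _∷_; length; _∷ʳ_)
open import Data.List.Relation.Unary.Unique.Propositional using (Unique)
open import Data.Product using (Σ; _×_; _,_; ∃-syntax)
open import Relation.Binary.PropositionalEquality using (_≡_; _≢_; refl)
open import Relation.Nullary using (¬_)

record Graph (V : Set) : Set where
  field
    adj        : V → V → Bool
    adj-sym    : ∀ u v → adj u v ≡ adj v u
    adj-irrefl : ∀ v → adj v v ≡ false
open Graph public

E : ∀ {V} → Graph V → V → V → Set
E G u v = adj G u v ≡ true

data Walk {V : Set} (R : V → V → Set) : V → V → Set where
  nil  : ∀ {v} → Walk R v v
  cons : ∀ {u v w} → R u v → Walk R v w → Walk R u w

Connected : ∀ {V} → Graph V → Set
Connected {V} G = (u v : V) → Walk (E G) u v

data Chain {V : Set} (R : V → V → Set) : List V → Set where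
  chain[]  : Chain R []
  chain[-] : ∀ {x} → Chain R (x ∷ [])
  chain∷   : ∀ {x y xs} → R x y → Chain R (y ∷ xs) → Chain R (x ∷ y ∷ xs)

HasCycle : ∀ {V} → Graph V → Set
HasCycle {V} G =
  Σ V λ v → Σ (List V) λ rest →
    (2 ≤ length rest) × Unique (v ∷ rest) × Chain (E G) ((v ∷ rest) ∷ʳ v)

Acyclic : ∀ {V} → Graph V → Set
Acyclic G = ¬ HasCycle G

record SpanningTree {V : Set} (G : Graph V) : Set where
  field
    tree      : Graph V
    subgraph  : ∀ u v → E tree u v → E G u v
    connected : Connected tree
    acyclic   : Acyclic tree
open SpanningTree public

DegreeAtLeast2 : ∀ {V} → Graph V → V → Set
DegreeAtLeast2 {V} H v = ∃[ u ] ∃[ w ] (u ≢ w × E H v u × E H v w)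

anyFin : ∀ n → (Fin n → Bool) → Bool
anyFin zero    f = false
anyFin (suc n) f = f Fin.zero ∨ anyFin n (λ i → f (Fin.suc i))

module _ {n : ℕ} (G : Graph (Fin n)) (X : Subset n) where

  inX : Fin n → Bool
  inX v = lookup X v

  inClosedNbhd : Fin n → Bool
  inClosedNbhd v = inX v ∨ anyFin n (λ u → inX u ∧ adj G u v)

  inOpenNbhd : Fin n → Bool
  inOpenNbhd v = inClosedNbhd v ∧ not (inX v)

  -- vertices of G': the vertices of N[X] (just) plus the new vertex r (nothing)
  V′ : Set
  V′ = Maybe (Σ (Fin n) λ v → inClosedNbhd v ≡ true)

  adj′ : V′ → V′ → Bool
  adj′ nothing nothing = false
  adj′ nothing (just (v , _)) = inOpenNbhd v
  adj′ (just (v , _)) nothing = inOpenNbhd v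
  adj′ (just (u , _)) (just (v , _)) = adj G u v

  private
    sym′ : ∀ a b → adj′ a b ≡ adj′ b a
    sym′ nothing nothing = refl
    sym′ nothing (just _) = refl
    sym′ (just _) nothing = refl
    sym′ (just (u , _)) (just (v , _)) = adj-sym G u v

    irr′ : ∀ a → adj′ a a ≡ false
    irr′ nothing = refl
    irr′ (just (v , _)) = adj-irrefl G v

  G′ : Graph V′
  G′ = record { adj = adj′ ; adj-sym = sym′ ; adj-irrefl = irr′ }

{-# OPTIONS --safe #-}
module Submission where

-- The edges of a spanning tree T of G with both ends in N[X] form a forest of G′ containing every
-- T-edge at a vertex of X. Conversely, deleting r from a spanning tree of G′ leaves a forest of G
-- containing every edge at a vertex of X, since r has no neighbour in X. In both directions the
-- forest extends to a spanning tree (Kruskal's algorithm, run first on the forest's own edges),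
-- which keeps the degrees at X. For the extension G′ must be connected: a vertex of X walks in G
-- to the first vertex outside X, which lies in N(X) and is therefore adjacent to r. This fails
-- only when X = V(G) ≠ ∅, and then the left side is false too, because a finite tree has a vertex
-- of degree at most 1.

open import Defs
open import Axiom.UniquenessOfIdentityProofs using (module Decidable⇒UIP)
open import Data.Bool using (Bool; true; false; _∨_; _∧_)
import Data.Bool as Bool
open import Data.Bool.Properties using (∨-comm; ∧-comm; ∨-zeroʳ)
open import Data.Empty using (⊥; ⊥-elim)
open import Data.Fin using (Fin)
import Data.Fin as Fin
open import Data.List using (List; []; _∷_; length; map; foldl; _++_; _∷ʳ_; [_]; cartesianProduct)
open import Data.List.Properties using (length-map; map-++; ++-assoc)
open import Data.List.Relation.Unary.All using (All; []; _∷_)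
import Data.List.Relation.Unary.All as All
open import Data.List.Relation.Unary.All.Properties using (¬Any⇒All¬; ∷ʳ⁺; ++⁻ˡ)
open import Data.List.Relation.Unary.AllPairs using ([]; _∷_)
open import Data.List.Relation.Unary.Any using (here; there)
open import Data.List.Relation.Unary.Unique.Propositional using (Unique)
open import Data.Maybe using (Maybe; just; nothing; fromMaybe)
import Data.Maybe as Maybe
open import Data.Maybe.Properties using (just-injective)
open import Data.Nat using (ℕ; zero; suc; _≤_; _<_; _+_; s≤s; z≤n)
open import Data.Nat.Properties using (<⇒≱; +-identityʳ; +-suc; n≤1+n)
open import Data.Product using (Σ; ∃; _×_; _,_; proj₁; proj₂)
open import Data.Sum using (_⊎_; inj₁; inj₂; [_,_]′)
open import Function using (_∘_)
open import Relation.Binary.Definitions using (DecidableEquality)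
open import Relation.Binary.PropositionalEquality
  using (_≡_; _≢_; refl; sym; trans; cong; cong₂; subst; subst₂; ≢-sym)
open import Relation.Nullary using (¬_; Dec; yes; no; does)
open import Relation.Nullary.Decidable using (dec-true; map′)


module FiniteGraphs where

  open import Data.List.Membership.Propositional using (_∈_)
  open import Data.List.Membership.Propositional.Properties using (∈-∃++; ∈-map⁺)

  private
    variable
      A B C D V W : Set
      R S : V → V → Set
      a b u v w x y z : V
      xs ys : List V

  ∨-true-introˡ : ∀ {p q} → p ≡ true → p ∨ q ≡ true
  ∨-true-introˡ refl = refl

  ∨-true-introʳ : ∀ p {q} → q ≡ true → p ∨ q ≡ true
  ∨-true-introʳ p refl = ∨-zeroʳ p

  ∨-true-elim : ∀ p {q} → p ∨ q ≡ true → p ≡ true ⊎ q ≡ true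
  ∨-true-elim true  _ = inj₁ refl
  ∨-true-elim false e = inj₂ e

  ∧-true-elim : ∀ p {q} → p ∧ q ≡ true → p ≡ true × q ≡ true
  ∧-true-elim true e = refl , e

  does-∧∨-true : (p : Dec A) (q : Dec B) (r : Dec C) (s : Dec D) →
                 (does p ∧ does q) ∨ (does r ∧ does s) ≡ true → (A × B) ⊎ (C × D)
  does-∧∨-true (yes a) (yes b) _       _       _  = inj₁ (a , b)
  does-∧∨-true _       _       (yes c) (yes d) _  = inj₂ (c , d)
  does-∧∨-true (yes _) (no _)  (no _)  _       ()
  does-∧∨-true (yes _) (no _)  (yes _) (no _)  ()
  does-∧∨-true (no _)  _       (no _)  _       ()
  does-∧∨-true (no _)  _       (yes _) (no _)  ()

  does-∧∨-false : (p : Dec A) (q : Dec B) → ¬ (A × B) →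
                  (does p ∧ does q) ∨ (does q ∧ does p) ≡ false
  does-∧∨-false (yes a) (yes b) ¬ab = ⊥-elim (¬ab (a , b))
  does-∧∨-false (yes _) (no _)  _   = refl
  does-∧∨-false (no _)  (yes _) _   = refl
  does-∧∨-false (no _)  (no _)  _   = refl

  anyFin-true : ∀ m (f : Fin m → Bool) i → f i ≡ true → anyFin m f ≡ true
  anyFin-true (suc m) f Fin.zero    e = ∨-true-introˡ e
  anyFin-true (suc m) f (Fin.suc i) e = ∨-true-introʳ (f Fin.zero) (anyFin-true m (f ∘ Fin.suc) i e)

  infix 4 _⊆ᴳ_
  _⊆ᴳ_ : Graph V → Graph V → Set
  H ⊆ᴳ K = ∀ {u v} → E H u v → E K u v

  E? : (G : Graph V) → ∀ u v → Dec (E G u v)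
  E? G u v = adj G u v Bool.≟ true

  E-sym : (G : Graph V) → E G u v → E G v u
  E-sym {u = u} {v} G e = trans (adj-sym G v u) e

  E⇒≢ : (G : Graph V) → E G u v → u ≢ v
  E⇒≢ {u = u} G e refl with () ← trans (sym (adj-irrefl G u)) e

  walk-map : (∀ {x y} → R x y → S x y) → Walk R u v → Walk S u v
  walk-map f nil        = nil
  walk-map f (cons r w) = cons (f r) (walk-map f w)

  walk-++ : Walk R u v → Walk R v w → Walk R u w
  walk-++ nil        w′ = w′
  walk-++ (cons r w) w′ = cons r (walk-++ w w′)

  walk-reverse : (∀ {x y} → R x y → R y x) → Walk R u v → Walk R v u
  walk-reverse f nil        = nil
  walk-reverse f (cons r w) = walk-++ (walk-reverse f w) (cons (f r) nil)

  walk-invariant : (c : V → W) → (∀ {x y} → R x y → c x ≡ c y) → Walk R u v → c u ≡ c v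
  walk-invariant c f nil        = refl
  walk-invariant c f (cons r w) = trans (f r) (walk-invariant c f w)

  lastOf : V → List V → V
  lastOf a []       = a
  lastOf _ (x ∷ xs) = lastOf x xs

  lastOf-∷ʳ : ∀ (a : V) xs v → lastOf a (xs ∷ʳ v) ≡ v
  lastOf-∷ʳ a []       v = refl
  lastOf-∷ʳ a (x ∷ xs) v = lastOf-∷ʳ x xs v

  lastOf-∈ : ∀ (a : V) xs → lastOf a xs ∈ a ∷ xs
  lastOf-∈ a []       = here refl
  lastOf-∈ a (x ∷ xs) = there (lastOf-∈ x xs)

  ∷ʳ-nonempty : ∀ (xs : List V) → 1 ≤ length (xs ∷ʳ v)
  ∷ʳ-nonempty []      = s≤s z≤n
  ∷ʳ-nonempty (_ ∷ _) = s≤s z≤n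

  Chain-map : (∀ {x y} → R x y → S x y) → Chain R xs → Chain S xs
  Chain-map f chain[]       = chain[]
  Chain-map f chain[-]      = chain[-]
  Chain-map f (chain∷ r ch) = chain∷ (f r) (Chain-map f ch)

  Chain-restrict : {P : V → Set} → (∀ {x y} → P x → P y → R x y → S x y) →
                   All P xs → Chain R xs → Chain S xs
  Chain-restrict f _                   chain[]       = chain[]
  Chain-restrict f _                   chain[-]      = chain[-]
  Chain-restrict f (px ∷ pxs@(py ∷ _)) (chain∷ r ch) = chain∷ (f px py r) (Chain-restrict f pxs ch)

  Chain-map⁺ : (g : V → W) → (∀ {x y} → R x y → S (g x) (g y)) → Chain R xs → Chain S (map g xs)
  Chain-map⁺ g f chain[]       = chain[]
  Chain-map⁺ g f chain[-]      = chain[-]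
  Chain-map⁺ g f (chain∷ r ch) = chain∷ (f r) (Chain-map⁺ g f ch)

  Chain-∷ʳ⁺ : Chain R (a ∷ xs) → R (lastOf a xs) v → Chain R ((a ∷ xs) ∷ʳ v)
  Chain-∷ʳ⁺ {xs = []}    chain[-]      r = chain∷ r chain[-]
  Chain-∷ʳ⁺ {xs = _ ∷ _} (chain∷ r ch) r′ = chain∷ r (Chain-∷ʳ⁺ ch r′)

  Chain-∷ʳ⁻ : Chain R ((a ∷ xs) ∷ʳ v) → Chain R (a ∷ xs) × R (lastOf a xs) v
  Chain-∷ʳ⁻ {xs = []}    (chain∷ r _)  = chain[-] , r
  Chain-∷ʳ⁻ {xs = _ ∷ _} (chain∷ r ch) with Chain-∷ʳ⁻ ch
  ... | ch′ , r′ = chain∷ r ch′ , r′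

  Chain-++⁻ˡ : ∀ xs → Chain R (xs ++ ys) → Chain R xs
  Chain-++⁻ˡ []           _             = chain[]
  Chain-++⁻ˡ (x ∷ [])     _             = chain[-]
  Chain-++⁻ˡ (x ∷ y ∷ xs) (chain∷ r ch) = chain∷ r (Chain-++⁻ˡ (y ∷ xs) ch)

  Chain-invariant : (c : V → W) → (∀ {x y} → R x y → c x ≡ c y) →
                    Chain R (a ∷ xs) → c a ≡ c (lastOf a xs)
  Chain-invariant c f chain[-]      = refl
  Chain-invariant c f (chain∷ r ch) = trans (f r) (Chain-invariant c f ch)

  Chain-sources : ∀ xs → Chain R (xs ∷ʳ v) → All (λ x → ∃ (R x)) xs
  Chain-sources []           _             = []
  Chain-sources (x ∷ [])     (chain∷ r _)  = (_ , r) ∷ []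
  Chain-sources (x ∷ y ∷ xs) (chain∷ r ch) = (_ , r) ∷ Chain-sources (y ∷ xs) ch

  Unique-∷ʳ⁺ : Unique xs → All (_≢ v) xs → Unique (xs ∷ʳ v)
  Unique-∷ʳ⁺ []           []           = [] ∷ []
  Unique-∷ʳ⁺ (x∉ ∷ u) (x≢v ∷ xs≢v) = ∷ʳ⁺ x∉ x≢v ∷ Unique-∷ʳ⁺ u xs≢v

  Unique-++⁻ˡ : ∀ xs → Unique (xs ++ ys) → Unique xs
  Unique-++⁻ˡ []       _        = []
  Unique-++⁻ˡ (x ∷ xs) (x∉ ∷ u) = ++⁻ˡ xs x∉ ∷ Unique-++⁻ˡ xs u

  Unique-map⁺ : {P : V → Set} (g : V → W) → (∀ {x y} → P x → P y → g x ≡ g y → x ≡ y) →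
                All P xs → Unique xs → Unique (map g xs)
  Unique-map⁺ g inj []         []       = []
  Unique-map⁺ g inj (px ∷ pxs) (x∉ ∷ u) = separated pxs x∉ ∷ Unique-map⁺ g inj pxs u
    where
      separated : ∀ {ys} → All _ ys → All (_ ≢_) ys → All (g _ ≢_) (map g ys)
      separated []         []           = []
      separated (py ∷ pys) (x≢y ∷ x∉ys) = (x≢y ∘ inj px py) ∷ separated pys x∉ys

  Cycle : (V → V → Set) → V → List V → Set
  Cycle R v rest = (2 ≤ length rest) × Unique (v ∷ rest) × Chain R ((v ∷ rest) ∷ʳ v)

  Cycle-closing : ∀ {pre post} → Chain R (x ∷ y ∷ pre ++ z ∷ post) →
                  Unique (x ∷ y ∷ pre ++ z ∷ post) → R z x → Cycle R x (y ∷ pre ∷ʳ z)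
  Cycle-closing {R = R} {x} {y} {z} {pre} {post} ch u zx =
    s≤s (∷ʳ-nonempty pre) ,
    Unique-++⁻ˡ (x ∷ y ∷ pre ∷ʳ z) (subst Unique split u) ,
    Chain-∷ʳ⁺ (Chain-++⁻ˡ (x ∷ y ∷ pre ∷ʳ z) (subst (Chain R) split ch))
              (subst (λ w → R w x) (sym (lastOf-∷ʳ y pre z)) zx)
    where
      split : x ∷ y ∷ pre ++ z ∷ post ≡ (x ∷ y ∷ pre ∷ʳ z) ++ post
      split = cong (λ l → x ∷ y ∷ l) (sym (++-assoc pre [ z ] post))

  Cycle-rotate¹ : Cycle R v (x ∷ xs) → Cycle R x (xs ∷ʳ v)
  Cycle-rotate¹ {xs = []}     (s≤s () , _)
  Cycle-rotate¹ {R = R} {v} {x} {xs = y ∷ ys} (_ , v∉ ∷ u , chain∷ vx ch) =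
    s≤s (∷ʳ-nonempty ys) ,
    Unique-∷ʳ⁺ u (All.map ≢-sym v∉) ,
    Chain-∷ʳ⁺ ch (subst (λ w → R w x) (sym (lastOf-∷ʳ y ys v)) vx)

  Cycle-rotate : Cycle R v xs → a ∈ v ∷ xs → ∃ (Cycle R a)
  Cycle-rotate c (here refl) = _ , c
  Cycle-rotate {R = R} {a = a} c (there a∈xs) with ∈-∃++ a∈xs
  ... | pre , post , refl = across pre c
    where
      across : ∀ pre {v post} → Cycle R v (pre ++ a ∷ post) → ∃ (Cycle R a)
      across []        c = _ , Cycle-rotate¹ c
      across (p ∷ pre) {v} {post} c =
        across pre (subst (Cycle R p) (++-assoc pre (a ∷ post) [ v ]) (Cycle-rotate¹ c))

  acyclic-reflect : {G : Graph V} {H : Graph W} (g : V → W) →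
                    (∀ {u v} → E G u v → E H (g u) (g v)) →
                    (∀ {u u′} → ∃ (E G u) → ∃ (E G u′) → g u ≡ g u′ → u ≡ u′) →
                    Acyclic H → Acyclic G
  acyclic-reflect {H = H} g hom inj acyclicH (v , rest , len , u , ch) =
    acyclicH (g v , map g rest , subst (2 ≤_) (sym (length-map g rest)) len ,
              Unique-map⁺ g inj (Chain-sources (v ∷ rest) ch) u ,
              subst (Chain (E H)) (map-++ g (v ∷ rest) [ v ]) (Chain-map⁺ g hom ch))

  record SimplePath (R : V → V → Set) (a b : V) : Set where
    constructor simplePath
    field
      rest    : List V
      chain   : Chain R (a ∷ rest)
      unique  : Unique (a ∷ rest)
      reaches : lastOf a rest ≡ b

  SimplePath-suffix : (p : SimplePath R u v) → a ∈ u ∷ SimplePath.rest p → SimplePath R a v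
  SimplePath-suffix p (here refl) = p
  SimplePath-suffix (simplePath []       _             _       _) (there ())
  SimplePath-suffix (simplePath (_ ∷ xs) (chain∷ _ ch) (_ ∷ u) e) (there a∈) =
    SimplePath-suffix (simplePath xs ch u e) a∈

  SimplePath⇒Cycle : (p : SimplePath R u v) → u ≢ v → ¬ R u v →
                     (∀ {x y} → R x y → S x y) → S v u → Cycle S u (SimplePath.rest p)
  SimplePath⇒Cycle (simplePath [] _ _ refl) u≢v _ _ _ = ⊥-elim (u≢v refl)
  SimplePath⇒Cycle (simplePath (_ ∷ []) (chain∷ r _) _ refl) _ ¬r _ _ = ⊥-elim (¬r r)
  SimplePath⇒Cycle (simplePath (_ ∷ _ ∷ _) ch uniq refl) _ _ f vu =
    s≤s (s≤s z≤n) , uniq , Chain-∷ʳ⁺ (Chain-map f ch) vu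

  adjᴹ : Graph W → Maybe W → Maybe W → Bool
  adjᴹ H (just a) (just b) = adj H a b
  adjᴹ H (just _) nothing  = false
  adjᴹ H nothing  _        = false

  pullback : (V → Maybe W) → Graph W → Graph V
  pullback f H = record
    { adj        = λ u v → adjᴹ H (f u) (f v)
    ; adj-sym    = λ u v → adjᴹ-sym (f u) (f v)
    ; adj-irrefl = λ v → adjᴹ-irrefl (f v) }
    where
      adjᴹ-sym : ∀ a b → adjᴹ H a b ≡ adjᴹ H b a
      adjᴹ-sym (just a) (just b) = adj-sym H a b
      adjᴹ-sym (just _) nothing  = refl
      adjᴹ-sym nothing  (just _) = refl
      adjᴹ-sym nothing  nothing  = refl

      adjᴹ-irrefl : ∀ a → adjᴹ H a a ≡ false
      adjᴹ-irrefl (just a) = adj-irrefl H a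
      adjᴹ-irrefl nothing  = refl

  module _ {f : V → Maybe W} {H : Graph W} where

    pullback-edge⁻ : E (pullback f H) u v →
                     Σ W λ a → Σ W λ b → f u ≡ just a × f v ≡ just b × E H a b
    pullback-edge⁻ {u} {v} e with f u | f v
    ... | just a  | just b  = a , b , refl , refl , e
    pullback-edge⁻ () | just _  | nothing
    pullback-edge⁻ () | nothing | _

    pullback-edge⁺ : f u ≡ just a → f v ≡ just b → E H a b → E (pullback f H) u v
    pullback-edge⁺ fu fv e rewrite fu | fv = e

    pullback-acyclic : (∀ {u v a} → f u ≡ just a → f v ≡ just a → u ≡ v) →
                       Acyclic H → Acyclic (pullback f H)
    pullback-acyclic _ _ (_ , [] , () , _)
    pullback-acyclic inj acyclicH cyc@(_ , _ ∷ _ , _ , _ , chain∷ e _) with pullback-edge⁻ e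
    ... | w₀ , _ = acyclic-reflect {G = pullback f H} {H = H} g hom g-inj acyclicH cyc
      where
        -- f is defined at every vertex of an edge, so any default w₀ makes it a homomorphism.
        g : V → W
        g = fromMaybe w₀ ∘ f

        g-just : ∀ {u a} → f u ≡ just a → g u ≡ a
        g-just fu = cong (fromMaybe w₀) fu

        hom : ∀ {u v} → E (pullback f H) u v → E H (g u) (g v)
        hom e with pullback-edge⁻ e
        ... | _ , _ , fu , fv , e′ = subst₂ (E H) (sym (g-just fu)) (sym (g-just fv)) e′

        g-inj : ∀ {u v} → ∃ (E (pullback f H) u) → ∃ (E (pullback f H) v) → g u ≡ g v → u ≡ v
        g-inj (_ , eu) (_ , ev) gu≡gv with pullback-edge⁻ eu | pullback-edge⁻ ev
        ... | _ , _ , fu , _ | _ , _ , fv , _ =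
          inj fu (trans fv (cong just (trans (sym (g-just fv)) (trans (sym gu≡gv) (g-just fu)))))

  Subtype : {V : Set} → (V → Bool) → Set
  Subtype {V} P = Σ V λ v → P v ≡ true

  module _ {P : V → Bool} where

    open Decidable⇒UIP Bool._≟_ using (≡-irrelevant)

    Subtype-≡ : {a b : Subtype P} → proj₁ a ≡ proj₁ b → a ≡ b
    Subtype-≡ {v , p} {.v , q} refl = cong (v ,_) (≡-irrelevant p q)

    Subtype-≟ : DecidableEquality V → DecidableEquality (Subtype P)
    Subtype-≟ _≟_ a b = map′ Subtype-≡ (cong proj₁) (proj₁ a ≟ proj₁ b)

    Maybe-proj₁-injective : {a b : Maybe (Subtype P)} →
                            Maybe.map proj₁ a ≡ just v → Maybe.map proj₁ b ≡ just v → a ≡ b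
    Maybe-proj₁-injective {a = just _} {just _} ea eb =
      cong just (Subtype-≡ (trans (just-injective ea) (sym (just-injective eb))))

    toSubtype : V → Maybe (Subtype P)
    toSubtype v with P v Bool.≟ true
    ... | yes p = just (v , p)
    ... | no _  = nothing

    toSubtype-sound : toSubtype v ≡ just a → proj₁ a ≡ v
    toSubtype-sound {v} e with P v Bool.≟ true
    toSubtype-sound refl | yes _ = refl

    toSubtype-true : (p : P v ≡ true) → toSubtype v ≡ just (v , p)
    toSubtype-true {v} p with P v Bool.≟ true
    ... | yes _  = cong just (Subtype-≡ refl)
    ... | no ¬p = ⊥-elim (¬p p)

    toSubtype-enumerates : (∀ v → v ∈ xs) → ∀ a → a ∈ nothing ∷ map toSubtype xs
    toSubtype-enumerates enum nothing        = here refl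
    toSubtype-enumerates enum (just (v , p)) =
      there (subst (_∈ map toSubtype _) (toSubtype-true p) (∈-map⁺ toSubtype (enum v)))

module DecidableGraphs {V : Set} (_≟_ : DecidableEquality V) where

  open FiniteGraphs
  open import Data.List.Membership.Propositional using (_∈_)
  open import Data.List.Membership.DecPropositional _≟_ using (_∈?_)
  open import Data.List.Membership.Propositional.Properties using (∈-∃++; ∈-cartesianProduct⁺)

  private
    variable
      R : V → V → Set
      a b u v w x y z : V
      xs ys : List V

  walk⇒simplePath : Walk R u v → SimplePath R u v
  walk⇒simplePath nil = simplePath [] chain[-] ([] ∷ []) refl
  walk⇒simplePath {u = u} (cons {v = x} r w) with walk⇒simplePath w
  ... | p@(simplePath xs ch uniq e) with u ∈? x ∷ xs
  ...   | yes u∈ = SimplePath-suffix p u∈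
  ...   | no  u∉ = simplePath (x ∷ xs) (chain∷ r ch) (¬Any⇒All¬ _ u∉ ∷ uniq) e

  remove : V → List V → List V
  remove x []       = []
  remove x (y ∷ ys) with x ≟ y
  ... | yes _ = ys
  ... | no  _ = y ∷ remove x ys

  length-remove : x ∈ ys → suc (length (remove x ys)) ≡ length ys
  length-remove {x} {y ∷ ys} x∈ with x ≟ y
  length-remove (here x≡y)  | no x≢y = ⊥-elim (x≢y x≡y)
  length-remove (there x∈)  | no _   = cong suc (length-remove x∈)
  length-remove _           | yes _  = refl

  ∈-remove : z ∈ ys → x ≢ z → z ∈ remove x ys
  ∈-remove {ys = y ∷ ys} {x} z∈ x≢z with x ≟ y
  ∈-remove (here refl) x≢z | yes x≡y = ⊥-elim (x≢z x≡y)
  ∈-remove (there z∈)  x≢z | yes _   = z∈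
  ∈-remove (here z≡y)  x≢z | no _    = here z≡y
  ∈-remove (there z∈)  x≢z | no _    = there (∈-remove z∈ x≢z)

  Unique-⊆⇒length≤ : Unique xs → (∀ {z} → z ∈ xs → z ∈ ys) → length xs ≤ length ys
  Unique-⊆⇒length≤ {[]}     _        _   = z≤n
  Unique-⊆⇒length≤ {x ∷ xs} {ys} (x∉ ∷ u) xs⊆ys =
    subst (suc (length xs) ≤_) (length-remove (xs⊆ys (here refl)))
      (s≤s (Unique-⊆⇒length≤ u (λ z∈ → ∈-remove (xs⊆ys (there z∈)) (All.lookup x∉ z∈))))

  joins : V → V → V → V → Bool
  joins a b x y = (does (x ≟ a) ∧ does (y ≟ b)) ∨ (does (x ≟ b) ∧ does (y ≟ a))

  addEdge : (H : Graph V) (a b : V) → a ≢ b → Graph V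
  addEdge H a b a≢b = record
    { adj        = λ x y → adj H x y ∨ joins a b x y
    ; adj-sym    = λ x y → cong₂ _∨_ (adj-sym H x y) (joins-sym x y)
    ; adj-irrefl = λ x → cong₂ _∨_ (adj-irrefl H x) (joins-irrefl x) }
    where
      joins-irrefl : ∀ x → joins a b x x ≡ false
      joins-irrefl x = does-∧∨-false (x ≟ a) (x ≟ b) λ (x≡a , x≡b) → a≢b (trans (sym x≡a) x≡b)

      joins-sym : ∀ x y → joins a b x y ≡ joins a b y x
      joins-sym x y = trans (∨-comm (does (x ≟ a) ∧ does (y ≟ b)) _)
                            (cong₂ _∨_ (∧-comm (does (x ≟ b)) _) (∧-comm (does (x ≟ a)) _))

  module _ (H : Graph V) {a b : V} (a≢b : a ≢ b) where

    addEdge⁻ : E (addEdge H a b a≢b) x y → E H x y ⊎ (x ≡ a × y ≡ b) ⊎ (x ≡ b × y ≡ a)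
    addEdge⁻ {x} {y} e with ∨-true-elim (adj H x y) e
    ... | inj₁ h = inj₁ h
    ... | inj₂ j = inj₂ (does-∧∨-true (x ≟ a) (y ≟ b) (x ≟ b) (y ≟ a) j)

    addEdge⁺ : E H x y → E (addEdge H a b a≢b) x y
    addEdge⁺ = ∨-true-introˡ

    addEdge-new : E (addEdge H a b a≢b) a b
    addEdge-new = ∨-true-introʳ (adj H a b)
                    (∨-true-introˡ (cong₂ _∧_ (dec-true (a ≟ a) refl) (dec-true (b ≟ b) refl)))

    addEdge-avoiding : a ≢ x → a ≢ y → E (addEdge H a b a≢b) x y → E H x y
    addEdge-avoiding a≢x a≢y e with addEdge⁻ e
    ... | inj₁ h                = h
    ... | inj₂ (inj₁ (x≡a , _)) = ⊥-elim (a≢x (sym x≡a))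
    ... | inj₂ (inj₂ (_ , y≡a)) = ⊥-elim (a≢y (sym y≡a))

    addEdge-from : E (addEdge H a b a≢b) a x → E H a x ⊎ x ≡ b
    addEdge-from e with addEdge⁻ e
    ... | inj₁ h                = inj₁ h
    ... | inj₂ (inj₁ (_ , x≡b)) = inj₂ x≡b
    ... | inj₂ (inj₂ (a≡b , _)) = ⊥-elim (a≢b a≡b)

    -- Rotate the cycle to start at a; the rest of it is an H-path, along which labels are
    -- constant, so neither of the two edges at a can be the new edge ab.
    addEdge-acyclic : (c : V → V) → (∀ {x y} → E H x y → c x ≡ c y) → c a ≢ c b → Acyclic H →
                      Acyclic (addEdge H a b a≢b)
    addEdge-acyclic c c-resp ca≢cb acyclicH (v , rest , len , uniq , ch) with a ∈? v ∷ rest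
    ... | no a∉ =
      acyclicH (v , rest , len , uniq ,
                Chain-restrict addEdge-avoiding (∷ʳ⁺ (¬Any⇒All¬ _ a∉) (a∉ ∘ here)) ch)
    ... | yes a∈ with Cycle-rotate (len , uniq , ch) a∈
    ... | []         , () , _
    ... | _ ∷ []     , s≤s () , _
    ... | s ∷ m ∷ ms , len′ , a∉ ∷ uniq′@(s∉ ∷ _) , chain∷ a-s ch′ with Chain-∷ʳ⁻ ch′
    ...   | ch″ , p-a = closing (addEdge-from a-s) (addEdge-from (E-sym (addEdge H a b a≢b) p-a))
      where
        p : V
        p = lastOf m ms

        chH : Chain (E H) (s ∷ m ∷ ms)
        chH = Chain-restrict addEdge-avoiding a∉ ch″

        cs≡cp : c s ≡ c p
        cs≡cp = Chain-invariant c c-resp chH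

        closing : E H a s ⊎ s ≡ b → E H a p ⊎ p ≡ b → ⊥
        closing (inj₁ a-s) (inj₁ a-p) =
          acyclicH (a , s ∷ m ∷ ms , len′ , a∉ ∷ uniq′ , Chain-∷ʳ⁺ (chain∷ a-s chH) (E-sym H a-p))
        closing (inj₁ a-s) (inj₂ p≡b) = ca≢cb (trans (c-resp a-s) (trans cs≡cp (cong c p≡b)))
        closing (inj₂ s≡b) (inj₁ a-p) = ca≢cb (trans (c-resp a-p) (trans (sym cs≡cp) (cong c s≡b)))
        closing (inj₂ s≡b) (inj₂ p≡b) = All.lookup s∉ (lastOf-∈ m ms) (trans s≡b (sym p≡b))

  module _ (c : V → V) (a b : V) where

    merge : V → V
    merge w with c w ≟ c b
    ... | yes _ = c a
    ... | no  _ = c w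

    merge-yes : c w ≡ c b → merge w ≡ c a
    merge-yes {w} e with c w ≟ c b
    ... | yes _ = refl
    ... | no ¬e = ⊥-elim (¬e e)

    merge-no : c w ≢ c b → merge w ≡ c w
    merge-no {w} ¬e with c w ≟ c b
    ... | yes e = ⊥-elim (¬e e)
    ... | no _  = refl

    merge-resp : c u ≡ c v → merge u ≡ merge v
    merge-resp {u} {v} e with c u ≟ c b
    ... | yes u~b = sym (merge-yes (trans (sym e) u~b))
    ... | no u≁b  = trans e (sym (merge-no (u≁b ∘ trans e)))

  record LabelledForest (G : Graph V) : Set where
    field
      forest          : Graph V
      forest⊆G        : forest ⊆ᴳ G
      forest-acyclic  : Acyclic forest
      label           : V → V
      label-resp      : ∀ {u v} → E forest u v → label u ≡ label v
      label-connected : ∀ u v → label u ≡ label v → Walk (E forest) u v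
  open LabelledForest

  emptyGraph : Graph V
  emptyGraph = record { adj = λ _ _ → false ; adj-sym = λ _ _ → refl ; adj-irrefl = λ _ → refl }

  emptyForest : (G : Graph V) → LabelledForest G
  emptyForest G = record
    { forest          = emptyGraph
    ; forest⊆G        = λ ()
    ; forest-acyclic  = λ { (_ , [] , () , _) ; (_ , _ ∷ _ , _ , _ , chain∷ () _) }
    ; label           = λ v → v
    ; label-resp      = λ ()
    ; label-connected = λ u v u≡v → subst (Walk _ u) u≡v nil }

  module _ {G : Graph V} (s : LabelledForest G) {x y : V} (xy : E G x y) (x≁y : label s x ≢ label s y) where

    private
      x≢y : x ≢ y
      x≢y = x≁y ∘ cong (label s)

      H : Graph V
      H = addEdge (forest s) x y x≢y

      c : V → V
      c = merge (label s) x y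

      c-yes : label s w ≡ label s y → c w ≡ label s x
      c-yes = merge-yes (label s) x y

      c-no : label s w ≢ label s y → c w ≡ label s w
      c-no = merge-no (label s) x y

      lift : Walk (E (forest s)) u v → Walk (E H) u v
      lift = walk-map (addEdge⁺ (forest s) x≢y)

      H⊆G : H ⊆ᴳ G
      H⊆G e with addEdge⁻ (forest s) x≢y e
      ... | inj₁ h                   = forest⊆G s h
      ... | inj₂ (inj₁ (refl , refl)) = xy
      ... | inj₂ (inj₂ (refl , refl)) = E-sym G xy

      cx≡cy : c x ≡ c y
      cx≡cy = trans (c-no x≁y) (sym (c-yes refl))

      c-resp : E H u v → c u ≡ c v
      c-resp e with addEdge⁻ (forest s) x≢y e
      ... | inj₁ h                   = merge-resp (label s) x y (label-resp s h)
      ... | inj₂ (inj₁ (refl , refl)) = cx≡cy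
      ... | inj₂ (inj₂ (refl , refl)) = sym cx≡cy

      c-connected : ∀ u v → c u ≡ c v → Walk (E H) u v
      c-connected u v cu≡cv = by-class (label s u ≟ label s y) (label s v ≟ label s y)
        where
          by-class : Dec (label s u ≡ label s y) → Dec (label s v ≡ label s y) → Walk (E H) u v
          by-class (yes u~y) (yes v~y) = lift (label-connected s u v (trans u~y (sym v~y)))
          by-class (yes u~y) (no v≁y)  =
            walk-++ (lift (label-connected s u y u~y))
              (cons (E-sym H (addEdge-new (forest s) x≢y))
                (lift (label-connected s x v (trans (sym (c-yes u~y)) (trans cu≡cv (c-no v≁y))))))
          by-class (no u≁y)  (yes v~y) =
            walk-++ (lift (label-connected s u x (trans (sym (c-no u≁y)) (trans cu≡cv (c-yes v~y)))))
              (cons (addEdge-new (forest s) x≢y) (lift (label-connected s y v (sym v~y))))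
          by-class (no u≁y)  (no v≁y)  =
            lift (label-connected s u v (trans (sym (c-no u≁y)) (trans cu≡cv (c-no v≁y))))

    join : LabelledForest G
    join = record
      { forest          = H
      ; forest⊆G        = H⊆G
      ; forest-acyclic  = addEdge-acyclic (forest s) x≢y (label s) (label-resp s) x≁y (forest-acyclic s)
      ; label           = c
      ; label-resp      = c-resp
      ; label-connected = c-connected }

    join-edge : E (forest join) x y
    join-edge = addEdge-new (forest s) x≢y

    join-keeps-edges : forest s ⊆ᴳ forest join
    join-keeps-edges = addEdge⁺ (forest s) x≢y

    join-keeps-labels : label s u ≡ label s v → label join u ≡ label join v
    join-keeps-labels = merge-resp (label s) x y

    join-new-edges : E (forest join) u v → E (forest s) u v ⊎ (u ≡ x × v ≡ y) ⊎ (u ≡ y × v ≡ x)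
    join-new-edges = addEdge⁻ (forest s) x≢y

  module Kruskal (G K : Graph V) (K⊆G : K ⊆ᴳ G) where

    record Grows (s t : LabelledForest G) : Set where
      field
        keeps-edges  : forest s ⊆ᴳ forest t
        keeps-labels : ∀ {u v} → label s u ≡ label s v → label t u ≡ label t v
        new-from-K   : ∀ {u v} → E (forest t) u v → E (forest s) u v ⊎ E K u v
    open Grows public

    grows-refl : ∀ {s} → Grows s s
    grows-refl = record { keeps-edges = λ e → e ; keeps-labels = λ e → e ; new-from-K = inj₁ }

    grows-trans : ∀ {s t r} → Grows s t → Grows t r → Grows s r
    grows-trans st tr = record
      { keeps-edges  = keeps-edges tr ∘ keeps-edges st
      ; keeps-labels = keeps-labels tr ∘ keeps-labels st
      ; new-from-K   = λ e → [ new-from-K st , inj₂ ]′ (new-from-K tr e) }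

    join-grows : ∀ s (k : E K x y) (x≁y : label s x ≢ label s y) → Grows s (join s (K⊆G k) x≁y)
    join-grows {x} {y} s k x≁y = record
      { keeps-edges  = join-keeps-edges s (K⊆G k) x≁y
      ; keeps-labels = join-keeps-labels s (K⊆G k) x≁y
      ; new-from-K   = classify ∘ join-new-edges s (K⊆G k) x≁y }
      where
        classify : ∀ {u v} → E (forest s) u v ⊎ (u ≡ x × v ≡ y) ⊎ (u ≡ y × v ≡ x) →
                   E (forest s) u v ⊎ E K u v
        classify (inj₁ h)                   = inj₁ h
        classify (inj₂ (inj₁ (refl , refl))) = inj₂ k
        classify (inj₂ (inj₂ (refl , refl))) = inj₂ (E-sym K k)

    step : LabelledForest G → V × V → LabelledForest G
    step s (x , y) with E? K x y | label s x ≟ label s y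
    ... | yes k | no x≁y = join s (K⊆G k) x≁y
    ... | _     | _      = s

    step-grows : ∀ s p → Grows s (step s p)
    step-grows s (x , y) with E? K x y | label s x ≟ label s y
    ... | yes k | no x≁y = join-grows s k x≁y
    ... | yes _ | yes _  = grows-refl
    ... | no _  | _      = grows-refl

    step-merges : ∀ s → E K x y → label (step s (x , y)) x ≡ label (step s (x , y)) y
    step-merges {x} {y} s k with E? K x y | label s x ≟ label s y
    ... | yes k′ | no x≁y = label-resp (join s (K⊆G k′) x≁y) (join-edge s (K⊆G k′) x≁y)
    ... | yes _  | yes x~y = x~y
    ... | no ¬k  | _       = ⊥-elim (¬k k)

    process : LabelledForest G → List (V × V) → LabelledForest G
    process = foldl step

    process-grows : ∀ s ps → Grows s (process s ps)
    process-grows s []       = grows-refl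
    process-grows s (p ∷ ps) = grows-trans (step-grows s p) (process-grows (step s p) ps)

    process-merges : ∀ s ps → (x , y) ∈ ps → E K x y →
                     label (process s ps) x ≡ label (process s ps) y
    process-merges s (_ ∷ ps) (here refl) k = keeps-labels (process-grows _ ps) (step-merges s k)
    process-merges s (_ ∷ ps) (there xy∈) k = process-merges _ ps xy∈ k

  -- Kruskal's algorithm, run first on the edges of F and then on those of G.
  spanningTree-extending : (vs : List V) → (∀ v → v ∈ vs) → (G : Graph V) → Connected G →
                           (F : Graph V) → F ⊆ᴳ G → Acyclic F →
                           Σ (SpanningTree G) λ T → F ⊆ᴳ tree T
  spanningTree-extending vs enum G Gconn F F⊆G acyclicF =
    T , onG.keeps-edges (onG.process-grows s₁ pairs) ∘ F⊆s₁
    where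
      module onF = Kruskal G F F⊆G
      module onG = Kruskal G G (λ e → e)

      pairs : List (V × V)
      pairs = cartesianProduct vs vs

      pair∈ : ∀ x y → (x , y) ∈ pairs
      pair∈ x y = ∈-cartesianProduct⁺ (enum x) (enum y)

      s₁ s₂ : LabelledForest G
      s₁ = onF.process (emptyForest G) pairs
      s₂ = onG.process s₁ pairs

      s₁⊆F : forest s₁ ⊆ᴳ F
      s₁⊆F e with onF.new-from-K (onF.process-grows (emptyForest G) pairs) e
      ... | inj₂ k = k

      -- an F-edge missing from s₁ would close a cycle with the s₁-path between its ends
      F⊆s₁ : F ⊆ᴳ forest s₁
      F⊆s₁ {x} {y} k with E? (forest s₁) x y
      ... | yes h = h
      ... | no ¬h = ⊥-elim (acyclicF (x , _ , SimplePath⇒Cycle path (E⇒≢ F k) ¬h s₁⊆F (E-sym F k)))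
        where
          path : SimplePath (E (forest s₁)) x y
          path = walk⇒simplePath
                   (label-connected s₁ x y (onF.process-merges (emptyForest G) pairs (pair∈ x y) k))

      T : SpanningTree G
      T = record
        { tree      = forest s₂
        ; subgraph  = λ _ _ → forest⊆G s₂
        ; connected = λ u v → label-connected s₂ u v
                        (walk-invariant (label s₂) (λ {x} {y} → onG.process-merges s₁ pairs (pair∈ x y))
                                        (Gconn u v))
        ; acyclic   = forest-acyclic s₂ }

  neighbour-≢ : (T : Graph V) → DegreeAtLeast2 T x → ∀ y → ∃ λ z → E T x z × z ≢ y
  neighbour-≢ T (a , b , a≢b , xa , xb) y with a ≟ y
  ... | yes refl = b , xb , ≢-sym a≢b
  ... | no a≢y   = a , xa , a≢y

  -- A non-backtracking path extended forever either returns to itself, closing a cycle, or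
  -- outgrows the number of vertices.
  minDegree2-forest-empty : (vs : List V) → (∀ v → v ∈ vs) → (T : Graph V) → Acyclic T →
                            (∀ v → DegreeAtLeast2 T v) → V → ⊥
  minDegree2-forest-empty vs enum T acyclicT deg2 v₀ with deg2 v₀
  ... | a , _ , _ , v₀a , _ =
    grow (length vs) (chain∷ (E-sym T v₀a) chain[-]) ((E⇒≢ T (E-sym T v₀a) ∷ []) ∷ [] ∷ [])
         (s≤s (n≤1+n _))
    where
      grow : ∀ fuel {x y ps} → Chain (E T) (x ∷ y ∷ ps) → Unique (x ∷ y ∷ ps) →
             length vs < length (x ∷ y ∷ ps) + fuel → ⊥
      grow zero ch u long =
        <⇒≱ long (subst (_≤ length vs) (sym (+-identityʳ _)) (Unique-⊆⇒length≤ u (λ {z} _ → enum z)))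
      grow (suc fuel) {x} {y} {ps} ch u long with neighbour-≢ T (deg2 x) y
      ... | z , xz , z≢y with z ∈? x ∷ y ∷ ps
      ... | no z∉ =
        grow fuel (chain∷ (E-sym T xz) ch) (¬Any⇒All¬ _ z∉ ∷ u) (subst (length vs <_) (+-suc _ fuel) long)
      ... | yes (here z≡x)         = E⇒≢ T xz (sym z≡x)
      ... | yes (there (here z≡y)) = z≢y z≡y
      ... | yes (there (there z∈ps)) with ∈-∃++ z∈ps
      ...   | pre , post , refl = acyclicT (x , _ , Cycle-closing ch u (E-sym T xz))

open FiniteGraphs
open DecidableGraphs using (spanningTree-extending; minDegree2-forest-empty)
open import Data.Bool using (not)
open import Data.Bool.Properties using (¬-not)
open import Data.Fin.Properties using (any?)
open import Data.Fin.Subset using (Subset; _∈_)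
open import Data.List using (allFin)
open import Data.List.Membership.Propositional.Properties using (∈-allFin)
open import Data.Maybe.Properties using (≡-dec)
open import Data.Vec.Properties using ([]=⇒lookup; lookup⇒[]=)
open import Function.Bundles using (_⇔_; mk⇔)

module _ {n : ℕ} (G : Graph (Fin n)) (X : Subset n) where

  private
    variable
      u v y : Fin n

  ∈⇒inX : v ∈ X → inX G X v ≡ true
  ∈⇒inX = []=⇒lookup

  inX⇒inN[X] : inX G X v ≡ true → inClosedNbhd G X v ≡ true
  inX⇒inN[X] = ∨-true-introˡ

  neighbour-inN[X] : inX G X v ≡ true → E G v u → inClosedNbhd G X u ≡ true
  neighbour-inN[X] {v} {u} v∈X vu =
    ∨-true-introʳ (inX G X u) (anyFin-true n (λ w → inX G X w ∧ adj G w u) v (cong₂ _∧_ v∈X vu))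

  root-adjacent : (p : inClosedNbhd G X v ≡ true) → inX G X v ≡ false →
                  E (G′ G X) (just (v , p)) nothing
  root-adjacent p v∉X = cong₂ (λ a b → a ∧ not b) p v∉X

  root-not-adjacent : inX G X v ≡ true → ∀ p → ¬ E (G′ G X) (just (v , p)) nothing
  root-not-adjacent {v} v∈X p e
    with () ← trans (cong not (sym v∈X)) (proj₂ (∧-true-elim (inClosedNbhd G X v) e))

  -- the walk leaves X at a vertex of N(X), which is adjacent to r
  walk-to-root : inX G X y ≡ false → inX G X v ≡ true → (p : inClosedNbhd G X v ≡ true) →
                 Walk (E G) v y → Walk (E (G′ G X)) (just (v , p)) nothing
  walk-to-root y∉X v∈X p nil with () ← trans (sym v∈X) y∉X
  walk-to-root y∉X v∈X p (cons {v = u} vu w) with inX G X u Bool.≟ true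
  ... | yes u∈X = cons {v = just (u , neighbour-inN[X] v∈X vu)} vu
                    (walk-to-root y∉X u∈X (neighbour-inN[X] v∈X vu) w)
  ... | no  u∉X = cons {v = just (u , neighbour-inN[X] v∈X vu)} vu
                    (cons (root-adjacent (neighbour-inN[X] v∈X vu) (¬-not u∉X)) nil)

  G′-connected : inX G X y ≡ false → Connected G → Connected (G′ G X)
  G′-connected {y} y∉X Gconn a b =
    walk-++ (to-root a) (walk-reverse (λ {a} {b} → E-sym {u = a} {b} (G′ G X)) (to-root b))
    where
      to-root : ∀ a → Walk (E (G′ G X)) a nothing
      to-root nothing        = nil
      to-root (just (v , p)) with inX G X v Bool.≟ true
      ... | yes v∈X = walk-to-root y∉X v∈X p (Gconn v y)
      ... | no  v∉X = cons (root-adjacent p (¬-not v∉X)) nil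

  V′-≟ : DecidableEquality (V′ G X)
  V′-≟ = ≡-dec (Subtype-≟ Fin._≟_)

  -- If X = V(G), the tree has minimum degree 2, so G is empty and G′ is the single vertex r.
  G′-connected-from-tree : Connected G → (T : SpanningTree G) →
                           (∀ v → v ∈ X → DegreeAtLeast2 (tree T) v) → Connected (G′ G X)
  G′-connected-from-tree Gconn T deg with any? (λ y → inX G X y Bool.≟ false)
  ... | yes (_ , y∉X) = G′-connected y∉X Gconn
  ... | no  X-full    = only-root
    where
      no-vertex : Fin n → ⊥
      no-vertex = minDegree2-forest-empty Fin._≟_ (allFin n) ∈-allFin (tree T) (acyclic T)
                    (λ v → deg v (lookup⇒[]= v X (¬-not (λ v∉X → X-full (v , v∉X)))))

      only-root : Connected (G′ G X)
      only-root nothing        nothing        = nil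
      only-root (just (v , _)) _              = ⊥-elim (no-vertex v)
      only-root nothing        (just (v , _)) = ⊥-elim (no-vertex v)

  tree⇒G′-tree : Connected G →
    (Σ (SpanningTree G) λ T → ∀ v → v ∈ X → DegreeAtLeast2 (tree T) v) →
    (Σ (SpanningTree (G′ G X)) λ T′ → ∀ v p → v ∈ X → DegreeAtLeast2 (tree T′) (just (v , p)))
  tree⇒G′-tree Gconn (T , deg) = proj₁ extension , deg′
    where
      F : Graph (V′ G X)
      F = pullback (Maybe.map proj₁) (tree T)

      F⊆G′ : F ⊆ᴳ G′ G X
      F⊆G′ {just (u , _)} {just (v , _)} e = subgraph T u v e

      extension : Σ (SpanningTree (G′ G X)) λ T′ → F ⊆ᴳ tree T′
      extension = spanningTree-extending V′-≟ _ (toSubtype-enumerates ∈-allFin) (G′ G X)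
                    (G′-connected-from-tree Gconn T deg)
                    F (λ {u} {v} → F⊆G′ {u} {v})
                    (pullback-acyclic {f = Maybe.map proj₁} Maybe-proj₁-injective (acyclic T))

      deg′ : ∀ v p → v ∈ X → DegreeAtLeast2 (tree (proj₁ extension)) (just (v , p))
      deg′ v p v∈X with deg v v∈X
      ... | u , w , u≢w , vu , vw =
        just (u , pu) , just (w , pw) , u≢w ∘ cong proj₁ ∘ just-injective ,
        proj₂ extension vu , proj₂ extension vw
        where
          pu : inClosedNbhd G X u ≡ true
          pu = neighbour-inN[X] (∈⇒inX v∈X) (subgraph T v u vu)
          pw : inClosedNbhd G X w ≡ true
          pw = neighbour-inN[X] (∈⇒inX v∈X) (subgraph T v w vw)

  G′-tree⇒tree : Connected G →
    (Σ (SpanningTree (G′ G X)) λ T′ → ∀ v p → v ∈ X → DegreeAtLeast2 (tree T′) (just (v , p))) →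
    (Σ (SpanningTree G) λ T → ∀ v → v ∈ X → DegreeAtLeast2 (tree T) v)
  G′-tree⇒tree Gconn (T′ , deg′) = proj₁ extension , deg
    where
      T′-r : Graph (Subtype (inClosedNbhd G X))
      T′-r = pullback (just ∘ just) (tree T′)

      F : Graph (Fin n)
      F = pullback toSubtype T′-r

      F⊆G : F ⊆ᴳ G
      F⊆G e with pullback-edge⁻ {f = toSubtype} {H = T′-r} e
      ... | a , b , fu , fv , ab =
        subst₂ (E G) (toSubtype-sound fu) (toSubtype-sound fv) (subgraph T′ (just a) (just b) ab)

      F-acyclic : Acyclic F
      F-acyclic = pullback-acyclic {f = toSubtype}
                    (λ fu fv → trans (sym (toSubtype-sound fu)) (toSubtype-sound fv))
                    (pullback-acyclic {f = just ∘ just} {H = tree T′} (λ { refl refl → refl }) (acyclic T′))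

      extension : Σ (SpanningTree G) λ T → F ⊆ᴳ tree T
      extension = spanningTree-extending Fin._≟_ (allFin n) ∈-allFin G Gconn F F⊆G F-acyclic

      lower : ∀ {v p} → inX G X v ≡ true → ∀ {a} → E (tree T′) (just (v , p)) a →
              Σ (Subtype (inClosedNbhd G X)) λ u → a ≡ just u × E F v (proj₁ u)
      lower {p = p} v∈X {nothing} e = ⊥-elim (root-not-adjacent v∈X p (subgraph T′ _ _ e))
      lower {p = p} v∈X {just u} e =
        u , refl , pullback-edge⁺ {f = toSubtype} {H = T′-r} (toSubtype-true p) (toSubtype-true (proj₂ u)) e

      deg : ∀ v → v ∈ X → DegreeAtLeast2 (tree (proj₁ extension)) v
      deg v v∈X with deg′ v (inX⇒inN[X] (∈⇒inX v∈X)) v∈X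
      ... | _ , _ , u≢w , vu , vw with lower (∈⇒inX v∈X) vu | lower (∈⇒inX v∈X) vw
      ... | u , refl , vu′ | w , refl , vw′ =
        proj₁ u , proj₁ w , u≢w ∘ cong just ∘ Subtype-≡ , proj₂ extension vu′ , proj₂ extension vw′

corollary1 : ∀ {n : ℕ} (G : Graph (Fin n)) (VNT : Subset n) → Connected G →
    (Σ (SpanningTree G) λ T → ∀ v → v ∈ VNT → DegreeAtLeast2 (tree T) v)
    ⇔
    (Σ (SpanningTree (G′ G VNT)) λ T →
      ∀ v (p : inClosedNbhd G VNT v ≡ true) → v ∈ VNT → DegreeAtLeast2 (tree T) (just (v , p)))
corollary1 G VNT Gconn = mk⇔ (tree⇒G′-tree G VNT Gconn) (G′-tree⇒tree G VNT Gconn)
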